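{- Let $(P,\leq,0,1)$ be a bounded relatively pseudocomplemented poset with relative pseudocomplement operation $*$, and for $x\in P$ let $x^*:=x*0$. Define $M(x,y):=L(x,y)$ and $R(x,y):=L(x*y)$ for all $x,y\in P$. Then $(P,\leq,{}^*,M,R,0,1)$ is an operator residuated poset satisfying divisibility, i.e. $M(R(x,y),x)=L(x,y)$ for all $x,y\in P$.
   Context: For a poset $(P,\leq)$ and $A\subseteq P$ let $L(A)=\{x\in P\mid x\leq y\text{ for all }y\in A\}$ and $U(A)=\{x\in P\mid y\leq x\text{ for all }y\in A\}$; we write $L(a)$ for $L(\{a\})$, $L(a,b)$ for $L(\{a,b\})$, etc. A poset is relatively pseudocomplemented if for all $a,b\in P$ there is a greatest element $c\in P$ with $L(a,c)\subseteq L(b)$; this $c$ is denoted $a*b$. An operator left residuated poset is a system $(P,\leq,{}',M,R,0,1)$ where $(P,\leq,0,1)$ is a bounded poset, $'$ is a unary operation on $P$, and $M,R$ are maps $P^2\to 2^P$ such that for all $x,y,z\in P$: (1) $M(x,1)=M(1,x)=L(x)$; (2) $R(x,y)=P$ iff $x\leq y$; (3) $M(x,y)\subseteq L(z)$ iff $L(x)\subseteq R(y,z)$; (4) $R(x,0)=L(x')$. It is called an operator residuated poset if moreover $M(x,y)=M(y,x)$ for all $x,y$. For $A,B\subseteq P$, $M(A,B):=\bigcup_{(x,y)\in A\times B}M(x,y)$ and $R(A,B):=\bigcup_{(x,y)\in A\times B}R(x,y)$ (elements identified with singletons); divisibility is the identity $M(R(x,y),x)=L(x,y)$. -}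

module Defs where

open import Level using (Level; _⊔_)
open import Data.Product using (_×_; Σ; ∃; ∃-syntax)
open import Relation.Binary.Bundles using (Poset)
open import Relation.Binary.PropositionalEquality using (_≡_)
open import Relation.Unary using (Pred; _⊆_; _≐_; U; ｛_｝)

module _ {c ℓ₁ ℓ₂ : Level} (P : Poset c ℓ₁ ℓ₂) where
  open Poset P renaming (Carrier to A)

  Lᵖ : {ℓ : Level} → Pred A ℓ → Pred A (c ⊔ ℓ ⊔ ℓ₂)
  Lᵖ S x = ∀ y → S y → x ≤ y

  Uᵖ : {ℓ : Level} → Pred A ℓ → Pred A (c ⊔ ℓ ⊔ ℓ₂)
  Uᵖ S x = ∀ y → S y → y ≤ x

  L₁ : A → Pred A ℓ₂
  L₁ a x = x ≤ a

  L₂ : A → A → Pred A ℓ₂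
  L₂ a b x = x ≤ a × x ≤ b

  IsBounded : A → A → Set (c ⊔ ℓ₂)
  IsBounded 0# 1# = ∀ x → (0# ≤ x) × (x ≤ 1#)

  IsRelPseudocomplement : (A → A → A) → Set (c ⊔ ℓ₂)
  IsRelPseudocomplement _*_ = ∀ a b →
    (L₂ a (a * b) ⊆ L₁ b) × (∀ z → L₂ a z ⊆ L₁ b → z ≤ a * b)

  -- extension of a map A² → 2^A to subsets
  lift : {ℓ ℓ' ℓ'' : Level} → (A → A → Pred A ℓ) → Pred A ℓ' → Pred A ℓ''
       → Pred A (c ⊔ ℓ ⊔ ℓ' ⊔ ℓ'')
  lift F S T z = ∃[ x ] ∃[ y ] (S x × T y × F x y z)

  record IsOperatorLeftResiduated {ℓ : Level} (_′ : A → A)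
      (M R : A → A → Pred A ℓ) (0# 1# : A) : Set (c ⊔ ℓ₂ ⊔ ℓ) where
    field
      bounded : IsBounded 0# 1#
      M-one   : ∀ x → (M x 1# ≐ L₁ x) × (M 1# x ≐ L₁ x)
      R-full  : ∀ x y → (R x y ≐ U → x ≤ y) × (x ≤ y → R x y ≐ U)
      adjoint : ∀ x y z → (M x y ⊆ L₁ z → L₁ x ⊆ R y z)
                        × (L₁ x ⊆ R y z → M x y ⊆ L₁ z)
      R-zero  : ∀ x → R x 0# ≐ L₁ (x ′)

  record IsOperatorResiduated {ℓ : Level} (_′ : A → A)
      (M R : A → A → Pred A ℓ) (0# 1# : A) : Set (c ⊔ ℓ₂ ⊔ ℓ) where
    field
      isLeftResiduated : IsOperatorLeftResiduated _′ M R 0# 1#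
      M-comm           : ∀ x y → M x y ≐ M y x

  Divisible : {ℓ : Level} → (M R : A → A → Pred A ℓ) → Set (c ⊔ ℓ₂ ⊔ ℓ)
  Divisible M R = ∀ x y → lift M (R x y) ｛ x ｝ ≐ L₂ x y

module Submission where

-- In a relatively pseudocomplemented poset the operation _*_
-- behaves like an implication: for all a, b, z we have
--     z ≤ a * b   iff   every lower bound of {a, z} lies below b,
-- which is exactly the residuation law  M(z,a) ⊆ L(b) ⇔ L(z) ⊆ R(a,b)
-- for M(x,y) = L(x,y) and R(x,y) = L(x*y).  Everything else follows from
-- two consequences of this characterisation: modus ponens
-- (z ≤ a, z ≤ a * b ⟹ z ≤ b) and  a ≤ b ⟹ a * b is the top element.
--
-- The theorem assembles these: the only use of boundedness is that 1 is
-- above every x, which gives the axiom M(x,1) = M(1,x) = L(x).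

open import Defs
open import Level using (Level)
open import Relation.Binary.Bundles using (Poset)
open import Relation.Binary.PropositionalEquality using (refl)
open import Relation.Unary using (_⊆_; _≐_; U)
open import Data.Product using (_×_; _,_; proj₁; proj₂)

module LowerCones {c ℓ₁ ℓ₂ : Level} (P : Poset c ℓ₁ ℓ₂) where
  open Poset P

  L₂-comm : ∀ x y → L₂ P x y ≐ L₂ P y x
  L₂-comm x y = (λ (z≤x , z≤y) → z≤y , z≤x) , (λ (z≤y , z≤x) → z≤x , z≤y)

  L₂-above : ∀ {x t} → x ≤ t → (L₂ P x t ≐ L₁ P x) × (L₂ P t x ≐ L₁ P x)
  L₂-above x≤t =
      (proj₁ , λ z≤x → z≤x , trans z≤x x≤t)
    , (proj₂ , λ z≤x → trans z≤x x≤t , z≤x)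

module RelativePseudocomplement {c ℓ₁ ℓ₂ : Level} (P : Poset c ℓ₁ ℓ₂)
    (_*_ : Poset.Carrier P → Poset.Carrier P → Poset.Carrier P)
    (rpc : IsRelPseudocomplement P _*_) where
  open Poset P renaming (refl to ≤-refl)

  modus-ponens : ∀ {a b z} → z ≤ a → z ≤ a * b → z ≤ b
  modus-ponens {a} {b} z≤a z≤a*b = proj₁ (rpc a b) (z≤a , z≤a*b)

  *-greatest : ∀ {a b} z → L₂ P a z ⊆ L₁ P b → z ≤ a * b
  *-greatest {a} {b} = proj₂ (rpc a b)

  residuation : ∀ x y z → (L₂ P x y ⊆ L₁ P z → L₁ P x ⊆ L₁ P (y * z))
                        × (L₁ P x ⊆ L₁ P (y * z) → L₂ P x y ⊆ L₁ P z)
  residuation x y z =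
      (λ L[x,y]⊆L[z] w≤x →
         trans w≤x (*-greatest x λ (v≤y , v≤x) → L[x,y]⊆L[z] (v≤x , v≤y)))
    , (λ L[x]⊆L[y*z] (w≤x , w≤y) → modus-ponens w≤y (L[x]⊆L[y*z] w≤x))

  *-top⇒≤ : ∀ {x y} → L₁ P (x * y) ≐ U → x ≤ y
  *-top⇒≤ (_ , U⊆L[x*y]) = modus-ponens ≤-refl (U⊆L[x*y] _)

  ≤⇒*-top : ∀ {x y} → x ≤ y → L₁ P (x * y) ≐ U
  ≤⇒*-top x≤y = (λ _ → _) , λ {z} _ → *-greatest z λ (w≤x , _) → trans w≤x x≤y

  -- One inclusion is modus ponens; for
  -- the other, a common lower bound z of x and y is its own witness a.
  divisibility : Divisible P (L₂ P) (λ x y → L₁ P (x * y))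
  divisibility x y =
      (λ { (a , .x , a≤x*y , refl , z≤a , z≤x) →
             z≤x , modus-ponens z≤x (trans z≤a a≤x*y) })
    , (λ { {z} (z≤x , z≤y) →
             z , x , *-greatest z (λ (_ , w≤z) → trans w≤z z≤y)
               , refl , ≤-refl , z≤x })

theorem1 : {c ℓ₁ ℓ₂ : Level} (P : Poset c ℓ₁ ℓ₂)
    (0# 1# : Poset.Carrier P) (_*_ : Poset.Carrier P → Poset.Carrier P → Poset.Carrier P)
    → IsBounded P 0# 1#
    → IsRelPseudocomplement P _*_
    → IsOperatorResiduated P (λ x → x * 0#) (L₂ P) (λ x y → L₁ P (x * y)) 0# 1#
    × Divisible P (L₂ P) (λ x y → L₁ P (x * y))
theorem1 P 0# 1# _*_ bounded rpc = operatorResiduated , divisibility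
  where
    open LowerCones P
    open RelativePseudocomplement P _*_ rpc

    operatorResiduated : IsOperatorResiduated P (λ x → x * 0#) (L₂ P)
                           (λ x y → L₁ P (x * y)) 0# 1#
    operatorResiduated = record
      { isLeftResiduated = record
        { bounded = bounded
        ; M-one   = λ x → L₂-above (proj₂ (bounded x))
        ; R-full  = λ x y → *-top⇒≤ , ≤⇒*-top
        ; adjoint = residuation
        ; R-zero  = λ x → (λ z≤x* → z≤x*) , (λ z≤x* → z≤x*)
        }
      ; M-comm = L₂-comm
      }
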